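{- Let $G$ be a finite simple graph. If $G$ belongs to Class 1, then its Mycielskian $M(G)$ belongs to Class 1.
   Context: A total dominator coloring (TDC) of a graph $G$ is a proper coloring in which every vertex is adjacent to every vertex of some color class; $\chi_d^t(G)$ is the minimum number of color classes in a TDC, and a $\chi_d^t$-coloring is a TDC with $\chi_d^t(G)$ colors. For a TDC $f=(V_1,\dots,V_\ell)$ with color classes $V_i$, $v\succ V_i$ means $v$ is adjacent to all vertices of $V_i$; $pn_G(V_i;f)$ is the set of vertices $v$ with $v\succ V_i$ and $v\not\succ V_j$ for all $j\ne i$. $G$ is in Class 1 if some $\chi_d^t$-coloring $f$ has $pn_G(V_i;f)=\emptyset$ for some $i$, and in Class 2 otherwise. If $V(G)=\{v_1,\dots,v_n\}$, the Mycielskian $M(G)$ has vertex set $V(G)\cup\{u_1,\dots,u_n\}\cup\{w\}$ and edge set $E(G)\cup\{u_iv_j : v_iv_j\in E(G)\}\cup\{u_iw : 1\le i\le n\}$. -}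

module Defs where

open import Data.Nat using (ℕ; _≤_)
open import Data.Fin using (Fin)
open import Data.Sum using (_⊎_; inj₁; inj₂)
open import Data.Unit using (⊤; tt)
open import Data.Empty using (⊥)
open import Data.Product using (Σ; ∃; _×_; _,_)
open import Relation.Binary.PropositionalEquality using (_≡_)
open import Relation.Nullary using (¬_)

record Graph (V : Set) : Set₁ where
  field
    Adj   : V → V → Set
    sym   : ∀ {x y} → Adj x y → Adj y x
    irref : ∀ {x} → ¬ Adj x x
open Graph public

module _ {V : Set} (G : Graph V) where

  Dom : ∀ {k} → (V → Fin k) → V → Fin k → Set
  Dom f v i = ∀ u → f u ≡ i → Adj G v u

  IsTDC : (k : ℕ) → (V → Fin k) → Set
  IsTDC k f =
      (∀ i → ∃ λ v → f v ≡ i)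
    × (∀ u v → Adj G u v → ¬ (f u ≡ f v))
    × (∀ v → ∃ λ i → Dom f v i)

  IsMinTDC : (k : ℕ) → (V → Fin k) → Set
  IsMinTDC k f = IsTDC k f × (∀ (k' : ℕ) (g : V → Fin k') → IsTDC k' g → k ≤ k')

  PnEmpty : ∀ {k} → (V → Fin k) → Fin k → Set
  PnEmpty f i = ∀ v → Dom f v i → ∃ λ j → ¬ (j ≡ i) × Dom f v j

  Class1 : Set
  Class1 = Σ ℕ λ k → Σ (V → Fin k) λ f → IsMinTDC k f × ∃ λ i → PnEmpty f i

-- Mycielskian: inj₁ (inj₁ i) = v_i, inj₁ (inj₂ i) = u_i, inj₂ tt = w
MVert : ℕ → Set
MVert n = (Fin n ⊎ Fin n) ⊎ ⊤

module _ {n : ℕ} (G : Graph (Fin n)) where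
  MAdj : MVert n → MVert n → Set
  MAdj (inj₁ (inj₁ i)) (inj₁ (inj₁ j)) = Adj G i j
  MAdj (inj₁ (inj₁ i)) (inj₁ (inj₂ j)) = Adj G j i
  MAdj (inj₁ (inj₂ i)) (inj₁ (inj₁ j)) = Adj G i j
  MAdj (inj₁ (inj₂ i)) (inj₁ (inj₂ j)) = ⊥
  MAdj (inj₁ (inj₁ i)) (inj₂ _) = ⊥
  MAdj (inj₁ (inj₂ i)) (inj₂ _) = ⊤
  MAdj (inj₂ _) (inj₁ (inj₁ j)) = ⊥
  MAdj (inj₂ _) (inj₁ (inj₂ j)) = ⊤
  MAdj (inj₂ _) (inj₂ _) = ⊥

  MSym : ∀ {x y} → MAdj x y → MAdj y x
  MSym {inj₁ (inj₁ i)} {inj₁ (inj₁ j)} a = sym G a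
  MSym {inj₁ (inj₁ i)} {inj₁ (inj₂ j)} a = a
  MSym {inj₁ (inj₂ i)} {inj₁ (inj₁ j)} a = a
  MSym {inj₁ (inj₂ i)} {inj₂ _} a = tt
  MSym {inj₂ _} {inj₁ (inj₂ j)} a = tt

  MIrref : ∀ {x} → ¬ MAdj x x
  MIrref {inj₁ (inj₁ i)} a = irref G a
  MIrref {inj₁ (inj₂ i)} ()
  MIrref {inj₂ _} ()

  Mycielskian : Graph (MVert n)
  Mycielskian = record { Adj = MAdj ; sym = λ {x} {y} → MSym {x} {y} ; irref = λ {x} → MIrref {x} }

-- Give every u_l one new colour and w the colour i of a class of the class-1
-- colouring f that is no vertex's only dominated class. Every vertex of M(G)
-- then dominates a class other than that of w, so the class of w is again
-- without private neighbours. The colouring is minimal: from a TDC of M(G) one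
-- reads off a proper colouring of G, in which every vertex dominates a nonempty
-- class, that misses a colour (the class dominated by w, or else the colour of
-- w); dropping its empty classes leaves a TDC of G with fewer colours.

module Submission where

open import Defs renaming (sym to Adj-sym)
open import Data.Nat using (ℕ; zero; suc; _≤_; _<_; s≤s)
open import Data.Nat.Properties using (≤-refl; ≤-trans; n≤1+n)
open import Data.Fin using (Fin; zero; suc; punchOut)
open import Data.Fin.Properties
  using (suc-injective; punchOut-injective; any?; all?; ¬∀⟶∃¬; _≟_)
open import Data.Sum using (_⊎_; inj₁; inj₂)
open import Data.Product using (Σ; ∃; _×_; _,_)
open import Data.Unit using (tt)
open import Data.Empty using (⊥-elim)
open import Relation.Nullary using (¬_; Dec; yes; no)
open import Relation.Nullary.Decidable using (_×-dec_; ¬?)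
open import Relation.Binary.Definitions using (DecidableEquality)
open import Relation.Binary.PropositionalEquality using (_≡_; _≢_; refl; sym; trans; cong; subst)
open import Function using (_∘_)

module _ {B : Set} (_≟ᴮ_ : DecidableEquality B) where

  fibreRep : ∀ {n} → (Fin n → B) → Fin n → Fin n
  fibreRep φ zero = zero
  fibreRep φ (suc l) with φ (suc l) ≟ᴮ φ zero
  ... | yes _ = zero
  ... | no _ = suc (fibreRep (φ ∘ suc) l)

  fibreRep-image : ∀ {n} (φ : Fin n → B) l → φ (fibreRep φ l) ≡ φ l
  fibreRep-image φ zero = refl
  fibreRep-image φ (suc l) with φ (suc l) ≟ᴮ φ zero
  ... | yes e = sym e
  ... | no _ = fibreRep-image (φ ∘ suc) l

  fibreRep-cong : ∀ {n} (φ : Fin n → B) {l m} → φ l ≡ φ m → fibreRep φ l ≡ fibreRep φ m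
  fibreRep-cong φ {zero} {zero} e = refl
  fibreRep-cong φ {zero} {suc m} e with φ (suc m) ≟ᴮ φ zero
  ... | yes _ = refl
  ... | no ne = ⊥-elim (ne (sym e))
  fibreRep-cong φ {suc l} {zero} e with φ (suc l) ≟ᴮ φ zero
  ... | yes _ = refl
  ... | no ne = ⊥-elim (ne e)
  fibreRep-cong φ {suc l} {suc m} e with φ (suc l) ≟ᴮ φ zero | φ (suc m) ≟ᴮ φ zero
  ... | yes _ | yes _ = refl
  ... | yes p | no q = ⊥-elim (q (trans (sym e) p))
  ... | no p | yes q = ⊥-elim (p (trans e q))
  ... | no _ | no _ = cong suc (fibreRep-cong (φ ∘ suc) e)

  fibreRep-idempotent : ∀ {n} (φ : Fin n → B) l → fibreRep φ (fibreRep φ l) ≡ fibreRep φ l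
  fibreRep-idempotent φ l = fibreRep-cong φ (fibreRep-image φ l)

module _ {V : Set} (G : Graph V) where

  Proper : ∀ {k} → (V → Fin k) → Set
  Proper f = ∀ u v → Adj G u v → ¬ (f u ≡ f v)

  IsWeakTDC : (k : ℕ) → (V → Fin k) → Set
  IsWeakTDC k f = Proper f × (∀ v → ∃ λ i → Dom G f v i × ∃ λ u → f u ≡ i)

  removeUnusedColour : ∀ {k} (f : V → Fin (suc k)) {y} → (∀ v → f v ≢ y) →
                       IsWeakTDC (suc k) f → Σ (V → Fin k) (IsWeakTDC k)
  removeUnusedColour f {y} unused (proper , dominates) = f′ , proper′ , dominates′
    where
    y≢f : ∀ v → y ≢ f v
    y≢f v = unused v ∘ sym

    f′ : V → Fin _
    f′ v = punchOut (y≢f v)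

    proper′ : Proper f′
    proper′ u v a = proper u v a ∘ punchOut-injective (y≢f u) (y≢f v)

    dominates′ : ∀ v → ∃ λ i → Dom G f′ v i × ∃ λ u → f′ u ≡ i
    dominates′ v with dominates v
    ... | i , d , u , refl =
      f′ u , (λ x e → d x (punchOut-injective (y≢f x) (y≢f u) e)) , u , refl

  dominatesNonPrivateClass : ∀ {k} {f : V → Fin k} {i} → (∀ v → ∃ λ j → Dom G f v j) →
                             PnEmpty G f i → ∀ v → ∃ λ j → j ≢ i × Dom G f v j
  dominatesNonPrivateClass {i = i} dominates pnEmpty v with dominates v
  ... | j , d with j ≟ i
  ...   | no j≢i = j , j≢i , d
  ...   | yes refl = pnEmpty v d

module _ {n : ℕ} (G : Graph (Fin n)) where

  weakTDC⇒TDC : ∀ k (f : Fin n → Fin k) → IsWeakTDC G k f →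
                ∃ λ k′ → k′ ≤ k × Σ (Fin n → Fin k′) (IsTDC G k′)
  weakTDC⇒TDC k f (proper , dominates) with all? (λ i → any? (λ v → f v ≟ i))
  ... | yes surjective =
    k , ≤-refl , f , surjective , proper , λ v → let (i , d , _) = dominates v in i , d
  weakTDC⇒TDC zero f wtdc | no notSurjective = ⊥-elim (notSurjective λ ())
  weakTDC⇒TDC (suc k) f wtdc | no notSurjective =
    let (y , unused) = ¬∀⟶∃¬ _ _ (λ i → any? (λ v → f v ≟ i)) notSurjective
        (f′ , wtdc′) = removeUnusedColour G f (λ v e → unused (v , e)) wtdc
        (k′ , k′≤k , rest) = weakTDC⇒TDC k f′ wtdc′
    in k′ , ≤-trans k′≤k (n≤1+n k) , rest

  χ<colours-of-nonSurjective-weakTDC :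
    ∀ {k k′} {h : Fin n → Fin k′} {y} → (∀ k″ (g : Fin n → Fin k″) → IsTDC G k″ g → k ≤ k″) →
    IsWeakTDC G k′ h → (∀ v → h v ≢ y) → k < k′
  χ<colours-of-nonSurjective-weakTDC {k′ = suc k′} {h} minimal wtdc unused =
    let (h′ , wtdc′) = removeUnusedColour G h unused wtdc
        (k″ , k″≤k′ , g , tdc) = weakTDC⇒TDC k′ h′ wtdc′
    in s≤s (≤-trans (minimal k″ g tdc) k″≤k′)

pattern orig l = inj₁ (inj₁ l)
pattern copy l = inj₁ (inj₂ l)
pattern apex = inj₂ tt

module _ {n : ℕ} (G : Graph (Fin n)) where

  private
    M : Graph (MVert n)
    M = Mycielskian G

  extendColouring : ∀ {k} → (Fin n → Fin k) → Fin k → MVert n → Fin (suc k)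
  extendColouring f i (orig l) = suc (f l)
  extendColouring f i (copy l) = zero
  extendColouring f i apex = suc i

  module _ {k : ℕ} {f : Fin n → Fin k} {i : Fin k} where

    extendColouring-surjective : (∀ j → ∃ λ l → f l ≡ j) →
                                 ∀ c → ∃ λ x → extendColouring f i x ≡ c
    extendColouring-surjective surjective zero = copy (let (l , _) = surjective i in l) , refl
    extendColouring-surjective surjective (suc j) = let (l , fl≡j) = surjective j in orig l , cong suc fl≡j

    extendColouring-proper : Proper G f → Proper M (extendColouring f i)
    extendColouring-proper proper (orig l) (orig m) a = proper l m a ∘ suc-injective
    extendColouring-proper proper (orig l) (copy m) a ()
    extendColouring-proper proper (copy l) (orig m) a ()
    extendColouring-proper proper (copy l) apex a ()
    extendColouring-proper proper apex (copy m) a ()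

    extendColouring-dominates : (∀ l → ∃ λ j → j ≢ i × Dom G f l j) →
                                ∀ x → ∃ λ c → c ≢ suc i × Dom M (extendColouring f i) x c
    extendColouring-dominates dominates (orig l) with dominates l
    ... | j , j≢i , d = suc j , j≢i ∘ suc-injective ,
      λ { (orig m) e → d m (suc-injective e) ; apex e → ⊥-elim (j≢i (sym (suc-injective e))) }
    extendColouring-dominates dominates (copy l) with dominates l
    ... | j , j≢i , d = suc j , j≢i ∘ suc-injective ,
      λ { (orig m) e → d m (suc-injective e) ; apex e → ⊥-elim (j≢i (sym (suc-injective e))) }
    extendColouring-dominates dominates apex = zero , (λ ()) , λ { (copy m) _ → tt }

  module _ {k : ℕ} {g : MVert n → Fin k} (tdc : IsTDC M k g) where

    private
      surjective : ∀ c → ∃ λ x → g x ≡ c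
      surjective = let (s , _ , _) = tdc in s

      proper : Proper M g
      proper = let (_ , p , _) = tdc in p

      dominates : ∀ x → ∃ λ c → Dom M g x c
      dominates = let (_ , _ , d) = tdc in d

    -- If w shares its colour with some v_l₀, restrict g to the original vertices:
    -- v_l dominates (within G) the class dominated by u_l, and the class dominated
    -- by w has no original vertex.
    restriction-weakTDC : ∀ {l₀} → g (orig l₀) ≡ g apex →
                          IsWeakTDC G k (g ∘ orig) × ∃ λ y → ∀ l → g (orig l) ≢ y
    restriction-weakTDC {l₀} l₀≡apex =
      ((λ l m → proper (orig l) (orig m)) , origDominates) ,
      (let (y , d) = dominates apex in y , λ l e → d (orig l) e)
      where
      origDominates : ∀ l → ∃ λ j → Dom G (g ∘ orig) l j × ∃ λ m → g (orig m) ≡ j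
      origDominates l with dominates (copy l)
      ... | j , d with j ≟ g apex | surjective j
      ...   | yes refl | _ = j , (λ m → d (orig m)) , l₀ , l₀≡apex
      ...   | no _ | orig m , e = j , (λ m → d (orig m)) , m , e
      ...   | no _ | copy m , e = ⊥-elim (d (copy m) e)
      ...   | no j≢apex | apex , e = ⊥-elim (j≢apex (sym e))

    -- If no v_l has the colour of w, let v_l take the colour of u_l when no original
    -- vertex uses it; taking one representative u_l per such colour keeps this proper.
    OrigColour : Fin k → Set
    OrigColour c = ∃ λ m → g (orig m) ≡ c

    Recoloured : Fin n → Set
    Recoloured l = ¬ OrigColour (g (copy l)) × fibreRep _≟_ (g ∘ copy) l ≡ l

    recoloured? : ∀ l → Dec (Recoloured l)
    recoloured? l = ¬? (any? (λ m → g (orig m) ≟ g (copy l))) ×-dec (fibreRep _≟_ (g ∘ copy) l ≟ l)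

    recoloured-unique : ∀ {l m} → Recoloured l → Recoloured m → g (copy l) ≡ g (copy m) → l ≡ m
    recoloured-unique (_ , rep-l) (_ , rep-m) e = trans (sym rep-l) (trans (fibreRep-cong _≟_ (g ∘ copy) e) rep-m)

    recolouring : Fin n → Fin k
    recolouring l with recoloured? l
    ... | yes _ = g (copy l)
    ... | no _ = g (orig l)

    recolouring-cases : ∀ l → recolouring l ≡ g (orig l) ⊎ (Recoloured l × recolouring l ≡ g (copy l))
    recolouring-cases l with recoloured? l
    ... | yes r = inj₂ (r , refl)
    ... | no _ = inj₁ refl

    recolouring-recoloured : ∀ {l} → Recoloured l → recolouring l ≡ g (copy l)
    recolouring-recoloured {l} r with recoloured? l
    ... | yes _ = refl
    ... | no ¬r = ⊥-elim (¬r r)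

    recolouring-proper : Proper G recolouring
    recolouring-proper l m a e with recolouring-cases l | recolouring-cases m
    ... | inj₁ el | inj₁ em = proper (orig l) (orig m) a (trans (sym el) (trans e em))
    ... | inj₂ (_ , el) | inj₁ em = proper (copy l) (orig m) a (trans (sym el) (trans e em))
    ... | inj₁ el | inj₂ (_ , em) = proper (orig l) (copy m) (Adj-sym G a) (trans (sym el) (trans e em))
    ... | inj₂ (rl , el) | inj₂ (rm , em) with recoloured-unique rl rm (trans (sym el) (trans e em))
    ...   | refl = irref G a

    recolouring-misses-apex : ¬ OrigColour (g apex) → ∀ l → recolouring l ≢ g apex
    recolouring-misses-apex noOrig l e with recolouring-cases l
    ... | inj₁ el = noOrig (l , trans (sym el) e)
    ... | inj₂ (_ , el) = proper (copy l) apex tt (trans (sym el) e)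

    recolouring-dom : ∀ {l j} → Dom M g (orig l) j → Dom G recolouring l j
    recolouring-dom d m e with recolouring-cases m
    ... | inj₁ em = d (orig m) (trans (sym em) e)
    ... | inj₂ (_ , em) = Adj-sym G (d (copy m) (trans (sym em) e))

    -- If v_p was recoloured, its new class is {v_p}, which v_l dominates.
    dominatesOrigClass : ∀ {l p} → Dom M g (orig l) (g (orig p)) →
                         ∃ λ c → Dom G recolouring l c × ∃ λ m → recolouring m ≡ c
    dominatesOrigClass {l} {p} d with recolouring-cases p
    ... | inj₁ ep = g (orig p) , recolouring-dom d , p , ep
    ... | inj₂ (rp@(noOrig , _) , ep) = recolouring p , singleton , p , refl
      where
      singleton : Dom G recolouring l (recolouring p)
      singleton m e with recolouring-cases m
      ... | inj₁ em = ⊥-elim (noOrig (m , trans (sym em) (trans e ep)))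
      ... | inj₂ (rm , em) with recoloured-unique rm rp (trans (sym em) (trans e ep))
      ...   | refl = d (orig m) refl

    dominatesCopyClass : ∀ {l m} → ¬ OrigColour (g (copy m)) → Dom M g (orig l) (g (copy m)) →
                         ∃ λ c → Dom G recolouring l c × ∃ λ r → recolouring r ≡ c
    dominatesCopyClass {m = m} noOrig d =
      g (copy m) , recolouring-dom d , r ,
      trans (recolouring-recoloured (noOrig′ , fibreRep-idempotent _≟_ (g ∘ copy) m)) rm
      where
      r : Fin n
      r = fibreRep _≟_ (g ∘ copy) m
      rm : g (copy r) ≡ g (copy m)
      rm = fibreRep-image _≟_ (g ∘ copy) m
      noOrig′ : ¬ OrigColour (g (copy r))
      noOrig′ (p , e) = noOrig (p , trans e rm)

    recolouring-weakTDC : IsWeakTDC G k recolouring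
    recolouring-weakTDC = recolouring-proper , recolouringDominates
      where
      recolouringDominates : ∀ l → ∃ λ c → Dom G recolouring l c × ∃ λ m → recolouring m ≡ c
      recolouringDominates l with dominates (orig l)
      ... | j , d with surjective j
      ...   | orig p , refl = dominatesOrigClass d
      ...   | apex , refl = ⊥-elim (d apex refl)
      ...   | copy m , refl with any? (λ p → g (orig p) ≟ g (copy m))
      ...     | yes (p , e) = dominatesOrigClass (subst (Dom M g (orig l)) (sym e) d)
      ...     | no noOrig = dominatesCopyClass noOrig d

    mycielskianTDC⇒nonSurjective-weakTDC :
      ∃ λ h → IsWeakTDC G k h × ∃ λ y → ∀ l → h l ≢ y
    mycielskianTDC⇒nonSurjective-weakTDC with any? (λ l → g (orig l) ≟ g apex)
    ... | yes (l₀ , e) = g ∘ orig , restriction-weakTDC e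
    ... | no noOrig = recolouring , recolouring-weakTDC , g apex , recolouring-misses-apex noOrig

lemma3p10 : (n : ℕ) (G : Graph (Fin n)) → Class1 G → Class1 (Mycielskian G)
lemma3p10 n G (k , f , ((surjective , proper , dominates) , minimal) , i , pnEmpty) =
  suc k , extendColouring G f i , (tdc , minimalM) , suc i , λ x _ → dominatesOther x
  where
  dominatesOther : ∀ x → ∃ λ c → c ≢ suc i × Dom (Mycielskian G) (extendColouring G f i) x c
  dominatesOther = extendColouring-dominates G (dominatesNonPrivateClass G dominates pnEmpty)

  tdc : IsTDC (Mycielskian G) (suc k) (extendColouring G f i)
  tdc = extendColouring-surjective G surjective , extendColouring-proper G proper ,
        λ x → let (c , _ , d) = dominatesOther x in c , d

  minimalM : ∀ k′ g → IsTDC (Mycielskian G) k′ g → suc k ≤ k′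
  minimalM k′ g tdcM =
    let (_ , wtdc , _ , unused) = mycielskianTDC⇒nonSurjective-weakTDC G tdcM
    in χ<colours-of-nonSurjective-weakTDC G minimal wtdc unused
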